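{- Let $G$ and $H$ be graphs without isolated vertices and let $k$ be a positive integer. Then \[ min_k(G\times H)\leq \min\{\,min_k(G)\,|V(H)|,\ min_k(H)\,|V(G)|\,\}.\]
   Context: All graphs are finite and simple. For a positive integer $k$, the irreversible $k$-threshold conversion process on a graph proceeds as follows. Every vertex is black or white at each discrete time step $t=0,1,2,\ldots$. A black vertex stays black forever. A white vertex becomes black at time $t$ if at least $k$ of its neighbors are black at time $t-1$. A $k$-conversion set of $G$ is a set $S\subseteq V(G)$ such that, if exactly the vertices of $S$ are black at time $0$, then every vertex of $G$ is eventually black. $min_k(G)$ denotes the minimum size of a $k$-conversion set of $G$. The tensor product $G\times H$ has vertex set $V(G)\times V(H)$. In it, $(u,u')$ and $(v,v')$ are adjacent if and only if $uv\in E(G)$ and $u'v'\in E(H)$. -}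

module Defs where

open import Data.Nat using (ℕ; zero; suc; _*_; _≤_; _≥_)
open import Data.Bool using (Bool; true; false; _∧_; _∨_; if_then_else_)
open import Data.Fin using (Fin)
open import Data.Fin.Subset using (Subset; ∣_∣)
open import Data.Fin.Properties using (_≟_)
open import Data.Vec using (lookup; tabulate)
open import Data.List using (List; length; filter)
open import Data.List using () renaming (allFin to allFinL)
open import Data.Product using (Σ; _×_; _,_; ∃)
open import Relation.Binary.PropositionalEquality using (_≡_)
open import Relation.Nullary using (¬_)
open import Relation.Nullary.Decidable using (⌊_⌋)
open import Data.Bool.Properties using (T?)
open import Data.Bool using (T)

record Graph : Set where
  field
    n     : ℕ
    adj   : Fin n → Fin n → Bool
    sym   : ∀ u v → adj u v ≡ adj v u
    irrefl : ∀ v → adj v v ≡ false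

open Graph public

∣V∣ : Graph → ℕ
∣V∣ G = n G

NoIsolated : Graph → Set
NoIsolated G = ∀ v → ∃ λ u → adj G v u ≡ true

blackNbrs : (G : Graph) → (Fin (n G) → Bool) → Fin (n G) → ℕ
blackNbrs G b v = length (filter (λ u → T? (adj G v u ∧ b u)) (allFinL (n G)))

_≤ᵇ_ : ℕ → ℕ → Bool
zero ≤ᵇ m = true
suc k ≤ᵇ zero = false
suc k ≤ᵇ suc m = k ≤ᵇ m

-- Colouring at time t of the irreversible k-threshold process started from S.
blackAt : (G : Graph) → ℕ → Subset (n G) → ℕ → Fin (n G) → Bool
blackAt G k S zero v = lookup S v
blackAt G k S (suc t) v = blackAt G k S t v ∨ (k ≤ᵇ blackNbrs G (blackAt G k S t) v)

IsConversionSet : (G : Graph) → ℕ → Subset (n G) → Set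
IsConversionSet G k S = ∃ λ t → ∀ v → blackAt G k S t v ≡ true

IsMinConv : (G : Graph) → ℕ → ℕ → Set
IsMinConv G k m =
  (∃ λ S → IsConversionSet G k S × ∣ S ∣ ≡ m)
  × (∀ S → IsConversionSet G k S → m ≤ ∣ S ∣)

-- Tensor product: vertex (i , j) encoded as Data.Fin.combine i j.
open import Data.Fin using (combine; remQuot)

open import Data.Bool.Properties using (∧-comm)
open import Relation.Binary.PropositionalEquality using (cong₂; cong)
open import Data.Product using (proj₁; proj₂)

tensorAdj : (G H : Graph) → Fin (n G * n H) → Fin (n G * n H) → Bool
tensorAdj G H x y =
  adj G (proj₁ (remQuot {n G} (n H) x)) (proj₁ (remQuot {n G} (n H) y))
  ∧ adj H (proj₂ (remQuot {n G} (n H) x)) (proj₂ (remQuot {n G} (n H) y))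

_⊗_ : Graph → Graph → Graph
G ⊗ H = record
  { n = n G * n H
  ; adj = tensorAdj G H
  ; sym = λ x y → cong₂ _∧_ (sym G (proj₁ (remQuot {n G} (n H) x)) (proj₁ (remQuot {n G} (n H) y))) (sym H (proj₂ (remQuot {n G} (n H) x)) (proj₂ (remQuot {n G} (n H) y)))
  ; irrefl = λ x → cong (_∧ adj H (proj₂ (remQuot {n G} (n H) x)) (proj₂ (remQuot {n G} (n H) x))) (irrefl G (proj₁ (remQuot {n G} (n H) x)))
  }

-- If S is a k-conversion set of G then S × V(H) is one of G × H.  Fix a
-- neighbour w′ of each w ∈ V(H) (H has no isolated vertices); then u ↦ (u , w′)
-- injects the black neighbours of v in G into the black neighbours of (v , w)
-- in G × H, so by induction on time (v , w) turns black no later than v does.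
-- The same argument with the factors exchanged gives the bound min_k(H) |V(G)|.
module Submission where

open import Defs hiding (sym)
open import Data.Nat using (ℕ; zero; suc; _+_; _*_; _≤_; _⊓_; z≤n; s≤s)
open import Data.Nat.Properties
  using (≤-refl; +-mono-≤; +-monoʳ-≤; +-assoc; *-comm; *-distribʳ-+; ⊓-glb; +-commutativeSemigroup; module ≤-Reasoning)
open import Algebra.Properties.CommutativeSemigroup +-commutativeSemigroup using (x∙yz≈y∙xz)
open import Data.Bool using (Bool; true; false; _∧_; _∨_)
open import Data.Bool.Properties using (T?; ∧-conicalˡ; ∧-conicalʳ; ∨-zeroʳ)
open import Data.Empty using (⊥-elim)
open import Data.Fin using (Fin; zero; suc; _↑ˡ_; _↑ʳ_; combine; remQuot; punchIn; punchOut)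
open import Data.Fin.Properties
  using (¬Fin0; 0≢1+n; suc-injective; remQuot-combine; combine-remQuot; punchIn-punchOut; punchOut-injective)
open import Data.Fin.Subset using (Subset; ∣_∣)
open import Data.Vec using ([]; _∷_; lookup; tabulate)
open import Data.Vec.Properties using (lookup∘tabulate)
open import Data.List using (length; filter)
import Data.List as List
open import Data.Product using (_,_; proj₁; proj₂; uncurry)
open import Function using (_∘_)
open import Function.Definitions using (Injective)
open import Relation.Binary.PropositionalEquality

bit : Bool → ℕ
bit false = 0
bit true  = 1

count : ∀ {N} → (Fin N → Bool) → ℕ
count {zero}  P = 0
count {suc N} P = bit (P zero) + count (P ∘ suc)

count-cong : ∀ {N} {P Q : Fin N → Bool} → (∀ i → P i ≡ Q i) → count P ≡ count Q
count-cong {zero}  P≗Q = refl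
count-cong {suc N} P≗Q = cong₂ _+_ (cong bit (P≗Q zero)) (count-cong (P≗Q ∘ suc))

bit-mono : ∀ {a b} → (a ≡ true → b ≡ true) → bit a ≤ bit b
bit-mono {false} a⇒b = z≤n
bit-mono {true}  a⇒b rewrite a⇒b refl = ≤-refl

count-mono : ∀ {N} {P Q : Fin N → Bool} → (∀ i → P i ≡ true → Q i ≡ true) → count P ≤ count Q
count-mono {zero}  P⇒Q = z≤n
count-mono {suc N} P⇒Q = +-mono-≤ (bit-mono (P⇒Q zero)) (count-mono (P⇒Q ∘ suc))

count-const : ∀ N b → count {N} (λ _ → b) ≡ bit b * N
count-const zero    false = refl
count-const zero    true  = refl
count-const (suc N) false = count-const N false
count-const (suc N) true  = cong suc (count-const N true)

count-↑ : ∀ N M (P : Fin (N + M) → Bool) → count P ≡ count (P ∘ (_↑ˡ M)) + count (P ∘ (N ↑ʳ_))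
count-↑ zero    M P = refl
count-↑ (suc N) M P =
  trans (cong (bit (P zero) +_) (count-↑ N M (P ∘ suc))) (sym (+-assoc (bit (P zero)) _ _))

count-punchIn : ∀ {N} (i : Fin (suc N)) (P : Fin (suc N) → Bool) →
                count P ≡ bit (P i) + count (P ∘ punchIn i)
count-punchIn           zero    P = refl
count-punchIn {suc N} (suc i) P =
  trans (cong (bit (P zero) +_) (count-punchIn i (P ∘ suc)))
        (x∙yz≈y∙xz (bit (P zero)) (bit (P (suc i))) _)

count-∘-injective : ∀ {M N} (f : Fin M → Fin N) → Injective _≡_ _≡_ f →
                    ∀ P → count (P ∘ f) ≤ count P
count-∘-injective {zero}          f f-inj P = z≤n
count-∘-injective {suc M} {zero}  f f-inj P = ⊥-elim (¬Fin0 (f zero))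
count-∘-injective {suc M} {suc N} f f-inj P = begin
  bit (P i) + count (P ∘ f ∘ suc)
    ≡⟨ cong (bit (P i) +_) (count-cong (λ j → cong P (sym (punchIn-punchOut (i≢f∘suc j))))) ⟩
  bit (P i) + count (P ∘ punchIn i ∘ g)
    ≤⟨ +-monoʳ-≤ (bit (P i)) (count-∘-injective g g-inj (P ∘ punchIn i)) ⟩
  bit (P i) + count (P ∘ punchIn i)
    ≡⟨ count-punchIn i P ⟨
  count P ∎
  where
  open ≤-Reasoning
  i = f zero
  i≢f∘suc : ∀ j → i ≢ f (suc j)
  i≢f∘suc j = 0≢1+n ∘ f-inj
  g : Fin M → Fin N
  g j = punchOut (i≢f∘suc j)
  g-inj : Injective _≡_ _≡_ g
  g-inj = suc-injective ∘ f-inj ∘ punchOut-injective (i≢f∘suc _) (i≢f∘suc _)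

length-filter-tabulate : ∀ {N} {A : Set} (P : A → Bool) (f : Fin N → A) →
                         length (filter (T? ∘ P) (List.tabulate f)) ≡ count (P ∘ f)
length-filter-tabulate {zero}  P f = refl
length-filter-tabulate {suc N} P f with P (f zero)
... | true  = cong suc (length-filter-tabulate P (f ∘ suc))
... | false = length-filter-tabulate P (f ∘ suc)

blackNbrs≡count : ∀ G b v → blackNbrs G b v ≡ count (λ u → adj G v u ∧ b u)
blackNbrs≡count G b v = length-filter-tabulate (λ u → adj G v u ∧ b u) (λ u → u)

∣S∣≡count : ∀ {N} (S : Subset N) → ∣ S ∣ ≡ count (lookup S)
∣S∣≡count []          = refl
∣S∣≡count (true ∷ S)  = cong suc (∣S∣≡count S)
∣S∣≡count (false ∷ S) = ∣S∣≡count S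

preimage : ∀ {M N} → (Fin M → Fin N) → Subset N → Subset M
preimage f S = tabulate (lookup S ∘ f)

∣preimage∣ : ∀ {M N} (f : Fin M → Fin N) S → ∣ preimage f S ∣ ≡ count (lookup S ∘ f)
∣preimage∣ f S = trans (∣S∣≡count (preimage f S)) (count-cong (lookup∘tabulate (lookup S ∘ f)))

remQuot-↑ʳ : ∀ {m} n (y : Fin (m * n)) →
             remQuot {suc m} n (n ↑ʳ y) ≡ (suc (proj₁ (remQuot {m} n y)) , proj₂ (remQuot {m} n y))
remQuot-↑ʳ {m} n y =
  trans (cong (remQuot {suc m} n ∘ (n ↑ʳ_)) (sym (combine-remQuot {m} n y)))
        (remQuot-combine (suc (proj₁ (remQuot {m} n y))) (proj₂ (remQuot {m} n y)))

count-remQuot : ∀ m n (h : Fin (suc m) → Fin n → Bool) →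
                count (uncurry h ∘ remQuot {suc m} n) ≡
                count (h zero) + count (uncurry (h ∘ suc) ∘ remQuot {m} n)
count-remQuot m n h = trans (count-↑ n (m * n) _)
  (cong₂ _+_ (count-cong (cong (uncurry h) ∘ remQuot-combine zero))
             (count-cong (cong (uncurry h) ∘ remQuot-↑ʳ n)))

count-∘proj₁ : ∀ m n (g : Fin m → Bool) → count (g ∘ proj₁ ∘ remQuot {m} n) ≡ count g * n
count-∘proj₁ zero    n g = refl
count-∘proj₁ (suc m) n g = begin
  count (g ∘ proj₁ ∘ remQuot n)
    ≡⟨ count-remQuot m n (λ i _ → g i) ⟩
  count {n} (λ _ → g zero) + count ((g ∘ suc) ∘ proj₁ ∘ remQuot {m} n)
    ≡⟨ cong₂ _+_ (count-const n (g zero)) (count-∘proj₁ m n (g ∘ suc)) ⟩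
  bit (g zero) * n + count (g ∘ suc) * n
    ≡⟨ *-distribʳ-+ n (bit (g zero)) _ ⟨
  count g * n
    ∎
  where open ≡-Reasoning

count-∘proj₂ : ∀ m n (g : Fin n → Bool) → count (g ∘ proj₂ ∘ remQuot {m} n) ≡ m * count g
count-∘proj₂ zero    n g = refl
count-∘proj₂ (suc m) n g = trans (count-remQuot m n (λ _ → g)) (cong (count g +_) (count-∘proj₂ m n g))

≤ᵇ-monoʳ : ∀ k {a b} → a ≤ b → (k ≤ᵇ a) ≡ true → (k ≤ᵇ b) ≡ true
≤ᵇ-monoʳ zero    a≤b       k≤a = refl
≤ᵇ-monoʳ (suc k) (s≤s a≤b) k≤a = ≤ᵇ-monoʳ k a≤b k≤a

∨-mono : ∀ {a b c d} → (a ≡ true → c ≡ true) → (b ≡ true → d ≡ true) → a ∨ b ≡ true → c ∨ d ≡ true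
∨-mono {true}          a⇒c b⇒d _   rewrite a⇒c refl = refl
∨-mono {false} {c = c} a⇒c b⇒d a∨b rewrite b⇒d a∨b  = ∨-zeroʳ c

record LocallySurjective (K G : Graph) : Set where
  field
    π        : Fin (n K) → Fin (n G)
    lift     : Fin (n K) → Fin (n G) → Fin (n K)
    π∘lift   : ∀ x u → π (lift x u) ≡ u
    lift-adj : ∀ x u → adj G (π x) u ≡ true → adj K x (lift x u) ≡ true

module _ {K G : Graph} (φ : LocallySurjective K G) where
  open LocallySurjective φ

  lift-injective : ∀ x → Injective _≡_ _≡_ (lift x)
  lift-injective x {u} {v} e = trans (sym (π∘lift x u)) (trans (cong π e) (π∘lift x v))

  blackNbrs-pullback : (bG : Fin (n G) → Bool) (bK : Fin (n K) → Bool) →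
                       (∀ y → bG (π y) ≡ true → bK y ≡ true) →
                       ∀ x → blackNbrs G bG (π x) ≤ blackNbrs K bK x
  blackNbrs-pullback bG bK bG⇒bK x = begin
    blackNbrs G bG (π x)                          ≡⟨ blackNbrs≡count G bG (π x) ⟩
    count (λ u → adj G (π x) u ∧ bG u)            ≤⟨ count-mono lifted ⟩
    count ((λ y → adj K x y ∧ bK y) ∘ lift x)     ≤⟨ count-∘-injective (lift x) (lift-injective x) _ ⟩
    count (λ y → adj K x y ∧ bK y)                ≡⟨ blackNbrs≡count K bK x ⟨
    blackNbrs K bK x                              ∎
    where
    open ≤-Reasoning
    lifted : ∀ u → adj G (π x) u ∧ bG u ≡ true → adj K x (lift x u) ∧ bK (lift x u) ≡ true
    lifted u e = cong₂ _∧_ (lift-adj x u (∧-conicalˡ _ _ e))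
                           (bG⇒bK (lift x u) (trans (cong bG (π∘lift x u)) (∧-conicalʳ _ _ e)))

  blackAt-pullback : ∀ k (S : Subset (n G)) (T : Subset (n K)) →
                     (∀ x → lookup S (π x) ≡ true → lookup T x ≡ true) →
                     ∀ t x → blackAt G k S t (π x) ≡ true → blackAt K k T t x ≡ true
  blackAt-pullback k S T S⇒T zero    x = S⇒T x
  blackAt-pullback k S T S⇒T (suc t) x =
    ∨-mono (IH x) (≤ᵇ-monoʳ k (blackNbrs-pullback (blackAt G k S t) (blackAt K k T t) IH x))
    where IH = blackAt-pullback k S T S⇒T t

  conversionSet-pullback : ∀ {k S} → IsConversionSet G k S → IsConversionSet K k (preimage π S)
  conversionSet-pullback {k} {S} (t , S-converts) =
    t , λ x → blackAt-pullback k S (preimage π S) (λ y → trans (lookup∘tabulate _ y)) t x (S-converts (π x))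

module _ (G H : Graph) where

  π₁ : Fin (n (G ⊗ H)) → Fin (n G)
  π₁ = proj₁ ∘ remQuot {n G} (n H)

  π₂ : Fin (n (G ⊗ H)) → Fin (n H)
  π₂ = proj₂ ∘ remQuot {n G} (n H)

  ⊗-adj-combine : ∀ x u w → adj (G ⊗ H) x (combine u w) ≡ adj G (π₁ x) u ∧ adj H (π₂ x) w
  ⊗-adj-combine x u w =
    cong (λ p → adj G (π₁ x) (proj₁ p) ∧ adj H (π₂ x) (proj₂ p)) (remQuot-combine u w)

  π₁-locallySurjective : NoIsolated H → LocallySurjective (G ⊗ H) G
  π₁-locallySurjective noIsolated = record
    { π        = π₁
    ; lift     = λ x u → combine u (neighbour x)
    ; π∘lift   = λ x u → cong proj₁ (remQuot-combine u (neighbour x))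
    ; lift-adj = λ x u e →
        trans (⊗-adj-combine x u (neighbour x)) (cong₂ _∧_ e (proj₂ (noIsolated (π₂ x))))
    }
    where
    neighbour : Fin (n (G ⊗ H)) → Fin (n H)
    neighbour x = proj₁ (noIsolated (π₂ x))

  π₂-locallySurjective : NoIsolated G → LocallySurjective (G ⊗ H) H
  π₂-locallySurjective noIsolated = record
    { π        = π₂
    ; lift     = λ x w → combine (neighbour x) w
    ; π∘lift   = λ x w → cong proj₂ (remQuot-combine (neighbour x) w)
    ; lift-adj = λ x w e →
        trans (⊗-adj-combine x (neighbour x) w) (cong₂ _∧_ (proj₂ (noIsolated (π₁ x))) e)
    }
    where
    neighbour : Fin (n (G ⊗ H)) → Fin (n G)
    neighbour x = proj₁ (noIsolated (π₁ x))

  ∣preimage-π₁∣ : ∀ S → ∣ preimage π₁ S ∣ ≡ ∣ S ∣ * ∣V∣ H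
  ∣preimage-π₁∣ S = trans (∣preimage∣ π₁ S)
    (trans (count-∘proj₁ (n G) (n H) (lookup S)) (cong (_* n H) (sym (∣S∣≡count S))))

  ∣preimage-π₂∣ : ∀ S → ∣ preimage π₂ S ∣ ≡ ∣ S ∣ * ∣V∣ G
  ∣preimage-π₂∣ S = trans (∣preimage∣ π₂ S)
    (trans (count-∘proj₂ (n G) (n H) (lookup S)) (trans (*-comm (n G) _) (cong (_* n G) (sym (∣S∣≡count S)))))

theorem6 : (G H : Graph) → NoIsolated G → NoIsolated H →
    (k : ℕ) → 1 ≤ k →
    (a b c : ℕ) → IsMinConv G k a → IsMinConv H k b → IsMinConv (G ⊗ H) k c →
    c ≤ (a * ∣V∣ H) ⊓ (b * ∣V∣ G)
theorem6 G H noIsolatedG noIsolatedH k _ a b c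
         ((S , S-converts , refl) , _) ((S′ , S′-converts , refl) , _) (_ , c-minimal) =
  ⊓-glb (subst (c ≤_) (∣preimage-π₁∣ G H S)
                (c-minimal _ (conversionSet-pullback (π₁-locallySurjective G H noIsolatedH) S-converts)))
        (subst (c ≤_) (∣preimage-π₂∣ G H S′)
                (c-minimal _ (conversionSet-pullback (π₂-locallySurjective G H noIsolatedG) S′-converts)))
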